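{- Let $\mathcal{S}\subseteq\{0,1\}^n$ be a set system. Suppose $Z\subseteq[n]$ and an integer $k\ge1$ are such that for every $i\in Z$ there exists $s\in\mathcal{S}$ with $i\in s$ and $|Z\cap s|\le k$. Then $|Z|\le k\cdot\mathrm{HHdim}(\mathcal{S})$.
   Context: Subsets of $[n]$ are identified with vectors in $\{0,1\}^n$; $u\circ v$ is the coordinatewise product and $\operatorname{supp}(v)=\{i:v_i\ne0\}$. $H(\mathcal{S},v)=\{i\in[n]:\exists s\in\mathcal{S}\text{ with }\operatorname{supp}(s\circ v)=\{i\}\}$ and $\mathrm{HHdim}(\mathcal{S})=\sup_{v\in\mathbb{R}^n}|H(\mathcal{S},v)|$. -}

module Defs where

open import Data.Bool using (Bool; true; false; if_then_else_; not)
import Data.Bool.Properties as BoolP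
open import Data.Nat using (ℕ; _≤_)
open import Data.Fin using (Fin)
open import Data.Fin.Subset using (Subset; ⁅_⁆; ∣_∣)
open import Data.Vec using (Vec; lookup; tabulate)
open import Data.Vec.Properties using (≡-dec)
open import Data.List using (List)
open import Data.List.Relation.Unary.Any using (any?)
open import Data.Rational using (ℚ; 0ℚ; 1ℚ; _*_)
import Data.Rational.Properties as ℚP
open import Relation.Nullary using (does)
open import Relation.Binary.PropositionalEquality using (_≡_)

-- Real vectors v ∈ ℝ^n are replaced by rational vectors.
Vecℚ : ℕ → Set
Vecℚ n = Fin n → ℚ

toℚ : ∀ {n} → Subset n → Vecℚ n
toℚ s i = if lookup s i then 1ℚ else 0ℚ

_∘ᶜ_ : ∀ {n} → Vecℚ n → Vecℚ n → Vecℚ n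
(u ∘ᶜ v) i = u i * v i

supp : ∀ {n} → Vecℚ n → Subset n
supp v = tabulate (λ i → not (does (v i ℚP.≟ 0ℚ)))

H : ∀ {n} → List (Subset n) → Vecℚ n → Subset n
H S v = tabulate (λ i →
  does (any? (λ s → ≡-dec BoolP._≟_ (supp (toℚ s ∘ᶜ v)) ⁅ i ⁆) S))

record IsHHdim {n : ℕ} (S : List (Subset n)) (d : ℕ) : Set where
  field
    upper : ∀ (v : Vecℚ n) → ∣ H S v ∣ ≤ d
    least : ∀ (e : ℕ) → (∀ (v : Vecℚ n) → ∣ H S v ∣ ≤ e) → d ≤ e

{-# OPTIONS --safe #-}
-- Only the sets of S meeting Z in at most k points matter, and they still cover Z.
-- Scan them in order: a set c whose points of Z are all covered by later sets is
-- dropped; otherwise some p ∈ Z ∩ c lies in no later set, p is recorded, the at most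
-- k points of Z ∩ c are discarded and the scan continues. The recorded points W
-- satisfy ∣Z∣ ≤ k ∣W∣, and each w ∈ W is the only point of W in the set that
-- recorded it. For v the indicator vector of W, supp (s ∘ v) = s ∩ W, so
-- W ⊆ H(S, v) and ∣W∣ ≤ HHdim(S).
module Submission where

open import Defs
open import Data.Nat using (ℕ; suc; z≤n; _≤_; _*_; _+_; _≤?_)
open import Data.Nat.Properties
  using (≤-trans; *-suc; +-suc; +-mono-≤; *-monoʳ-≤; ≤-reflexive; module ≤-Reasoning)
open import Data.Bool using (true; false; _∧_; not; if_then_else_)
open import Data.Fin using (Fin; zero; suc)
import Data.Fin.Properties as Fin
open import Data.Fin.Subset
  using (Subset; inside; outside; _∈_; _∉_; _⊆_; _∩_; _∪_; _─_; ⁅_⁆; ⊥; ∣_∣)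
open import Data.Fin.Subset.Properties
open import Data.Vec using ([]; _∷_; lookup; tabulate; here; there)
open import Data.Vec.Properties
  using (≡-dec; lookup-zipWith; lookup∘tabulate; tabulate∘lookup; tabulate-cong; lookup⇒[]=)
open import Data.List using (List; []; _∷_; filter)
open import Data.List.Relation.Unary.Any as Any using (Any; here; there)
open import Data.List.Relation.Unary.Any.Properties using (¬Any[])
import Data.List.Membership.Propositional as LM
open import Data.List.Membership.Propositional.Properties using (∈-filter⁺; ∈-filter⁻)
open import Data.Product using (Σ; ∃-syntax; _×_; _,_; proj₁; proj₂)
open import Data.Sum using (inj₁; inj₂)
open import Data.Rational using (1ℚ; 0ℚ) renaming (_*_ to _*ℚ_)
import Data.Rational.Properties as ℚ
open import Data.Bool.Properties using () renaming (_≟_ to _≟ᵇ_)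
open import Function using (_∘_)
open import Relation.Nullary using (¬_; Dec; yes; no; does; contradiction)
open import Relation.Nullary.Decidable using (dec-true; decidable-stable; _×-dec_; ¬?)
open import Relation.Binary.PropositionalEquality
  using (_≡_; refl; sym; trans; cong; cong₂; subst; module ≡-Reasoning)

private variable
  n : ℕ
  x : Fin n
  p : Subset n

x∈p─q⇒x∉q : ∀ (p q : Subset n) → x ∈ p ─ q → x ∉ q
x∈p─q⇒x∉q (_ ∷ p) (outside ∷ q) (there x∈p─q) (there x∈q) = x∈p─q⇒x∉q p q x∈p─q x∈q
x∈p─q⇒x∉q (_ ∷ p) (inside ∷ q)  (there x∈p─q) (there x∈q) = x∈p─q⇒x∉q p q x∈p─q x∈q

∣p∣≡∣p∩q∣+∣p─q∣ : ∀ (p q : Subset n) → ∣ p ∣ ≡ ∣ p ∩ q ∣ + ∣ p ─ q ∣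
∣p∣≡∣p∩q∣+∣p─q∣ []            []            = refl
∣p∣≡∣p∩q∣+∣p─q∣ (outside ∷ p) (outside ∷ q) = ∣p∣≡∣p∩q∣+∣p─q∣ p q
∣p∣≡∣p∩q∣+∣p─q∣ (outside ∷ p) (inside ∷ q)  = ∣p∣≡∣p∩q∣+∣p─q∣ p q
∣p∣≡∣p∩q∣+∣p─q∣ (inside ∷ p)  (inside ∷ q)  = cong suc (∣p∣≡∣p∩q∣+∣p─q∣ p q)
∣p∣≡∣p∩q∣+∣p─q∣ (inside ∷ p)  (outside ∷ q) =
  trans (cong suc (∣p∣≡∣p∩q∣+∣p─q∣ p q)) (sym (+-suc _ _))

x∉p⇒∣⁅x⁆∪p∣≡1+∣p∣ : x ∉ p → ∣ ⁅ x ⁆ ∪ p ∣ ≡ suc ∣ p ∣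
x∉p⇒∣⁅x⁆∪p∣≡1+∣p∣ {x = zero}  {outside ∷ p} _   = cong (suc ∘ ∣_∣) (∪-identityˡ p)
x∉p⇒∣⁅x⁆∪p∣≡1+∣p∣ {x = zero}  {inside ∷ p}  x∉p = contradiction here x∉p
x∉p⇒∣⁅x⁆∪p∣≡1+∣p∣ {x = suc x} {outside ∷ p} x∉p = x∉p⇒∣⁅x⁆∪p∣≡1+∣p∣ (x∉p ∘ there)
x∉p⇒∣⁅x⁆∪p∣≡1+∣p∣ {x = suc x} {inside ∷ p}  x∉p = cong suc (x∉p⇒∣⁅x⁆∪p∣≡1+∣p∣ (x∉p ∘ there))

x∈p⇒p∩⁅x⁆≡⁅x⁆ : x ∈ p → p ∩ ⁅ x ⁆ ≡ ⁅ x ⁆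
x∈p⇒p∩⁅x⁆≡⁅x⁆ {p = p} x∈p = ⊆-antisym (p∩q⊆q p _) λ y∈⁅x⁆ →
  x∈p∩q⁺ (subst (_∈ p) (sym (x∈⁅y⁆⇒x≡y _ y∈⁅x⁆)) x∈p , y∈⁅x⁆)

x∉p⇒p∩⁅x⁆≡⊥ : x ∉ p → p ∩ ⁅ x ⁆ ≡ ⊥
x∉p⇒p∩⁅x⁆≡⊥ {p = p} x∉p = Empty-unique λ (y , y∈p∩⁅x⁆) →
  let y∈p , y∈⁅x⁆ = x∈p∩q⁻ p _ y∈p∩⁅x⁆ in x∉p (subst (_∈ p) (x∈⁅y⁆⇒x≡y _ y∈⁅x⁆) y∈p)

Covers : List (Subset n) → Subset n → Set
Covers C Z = ∀ {z} → z ∈ Z → Any (z ∈_) C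

Isolated : List (Subset n) → Subset n → Set
Isolated C W = ∀ {w} → w ∈ W → ∃[ c ] c LM.∈ C × c ∩ W ≡ ⁅ w ⁆

isolated-⊆ : ∀ {C S} {W : Subset n} → (∀ {c} → c LM.∈ C → c LM.∈ S) → Isolated C W → Isolated S W
isolated-⊆ C⊆S isolated w∈W = let c , c∈C , c∩W≡⁅w⁆ = isolated w∈W in c , C⊆S c∈C , c∩W≡⁅w⁆

covers-∷⁻ : ∀ {c C} {Z : Subset n} → Covers (c ∷ C) Z → Covers C (Z ─ c)
covers-∷⁻ {c = c} {Z = Z} cover z∈Z─c with cover (p─q⊆p Z c z∈Z─c)
... | here z∈c = contradiction z∈c (x∈p─q⇒x∉q Z c z∈Z─c)
... | there z∈⋃C = z∈⋃C

covers-redundant : ∀ {c C} {Z : Subset n} → Covers (c ∷ C) Z →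
  ¬ (∃[ p ] p ∈ Z × p ∈ c × ¬ Any (p ∈_) C) → Covers C Z
covers-redundant {C = C} cover noPrivate {z} z∈Z with cover z∈Z
... | here z∈c = decidable-stable (Any.any? (z ∈?_) C) λ z∉⋃C → noPrivate (z , z∈Z , z∈c , z∉⋃C)
... | there z∈⋃C = z∈⋃C

record LargeIsolatedSubset (k : ℕ) (C : List (Subset n)) (Z : Subset n) : Set where
  field
    W         : Subset n
    W⊆Z       : W ⊆ Z
    ∣Z∣≤k*∣W∣ : ∣ Z ∣ ≤ k * ∣ W ∣
    isolated  : Isolated C W

module _ {k : ℕ} where

  largeIsolatedSubset-[] : ∀ {n} {Z : Subset n} → Covers [] Z → LargeIsolatedSubset k [] Z
  largeIsolatedSubset-[] {n} {Z} cover = record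
    { W         = ⊥
    ; W⊆Z       = ⊆-min Z
    ; ∣Z∣≤k*∣W∣ = ≤-trans (≤-reflexive (trans (cong ∣_∣ Z≡⊥) (∣⊥∣≡0 n))) z≤n
    ; isolated  = λ w∈⊥ → contradiction w∈⊥ ∉⊥
    }
    where
    Z≡⊥ : Z ≡ ⊥
    Z≡⊥ = Empty-unique λ (_ , z∈Z) → ¬Any[] (cover z∈Z)

  largeIsolatedSubset-skip : ∀ {c C} {Z : Subset n} →
    LargeIsolatedSubset k C Z → LargeIsolatedSubset k (c ∷ C) Z
  largeIsolatedSubset-skip r = record
    { LargeIsolatedSubset r
    ; isolated = isolated-⊆ there (LargeIsolatedSubset.isolated r)
    }

  largeIsolatedSubset-extend : ∀ {c C} {Z : Subset n} {p} →
    p ∈ Z → p ∈ c → ¬ Any (p ∈_) C → ∣ Z ∩ c ∣ ≤ k →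
    LargeIsolatedSubset k C (Z ─ c) → LargeIsolatedSubset k (c ∷ C) Z
  largeIsolatedSubset-extend {c = c} {C} {Z} {p} p∈Z p∈c p∉⋃C ∣Z∩c∣≤k r = record
    { W         = ⁅ p ⁆ ∪ W
    ; W⊆Z       = ⁅p⁆∪W⊆Z
    ; ∣Z∣≤k*∣W∣ = ∣Z∣≤k*∣⁅p⁆∪W∣
    ; isolated  = ⁅p⁆∪W-isolated
    }
    where
    open LargeIsolatedSubset r

    x∈W⇒x∉c : ∀ {x} → x ∈ W → x ∉ c
    x∈W⇒x∉c x∈W = x∈p─q⇒x∉q Z c (W⊆Z x∈W)

    ⁅p⁆∪W⊆Z : ⁅ p ⁆ ∪ W ⊆ Z
    ⁅p⁆∪W⊆Z x∈⁅p⁆∪W with x∈p∪q⁻ ⁅ p ⁆ W x∈⁅p⁆∪W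
    ... | inj₁ x∈⁅p⁆ = subst (_∈ Z) (sym (x∈⁅y⁆⇒x≡y p x∈⁅p⁆)) p∈Z
    ... | inj₂ x∈W   = p─q⊆p Z c (W⊆Z x∈W)

    ∣Z∣≤k*∣⁅p⁆∪W∣ : ∣ Z ∣ ≤ k * ∣ ⁅ p ⁆ ∪ W ∣
    ∣Z∣≤k*∣⁅p⁆∪W∣ = begin
      ∣ Z ∣                      ≡⟨ ∣p∣≡∣p∩q∣+∣p─q∣ Z c ⟩
      ∣ Z ∩ c ∣ + ∣ Z ─ c ∣      ≤⟨ +-mono-≤ ∣Z∩c∣≤k ∣Z∣≤k*∣W∣ ⟩
      k + k * ∣ W ∣              ≡⟨ *-suc k ∣ W ∣ ⟨
      k * suc ∣ W ∣              ≡⟨ cong (k *_) (x∉p⇒∣⁅x⁆∪p∣≡1+∣p∣ (λ p∈W → x∈W⇒x∉c p∈W p∈c)) ⟨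
      k * ∣ ⁅ p ⁆ ∪ W ∣          ∎
      where open ≤-Reasoning

    c∩W≡⊥ : c ∩ W ≡ ⊥
    c∩W≡⊥ = Empty-unique λ (x , x∈c∩W) →
      let x∈c , x∈W = x∈p∩q⁻ c W x∈c∩W in x∈W⇒x∉c x∈W x∈c

    ⁅p⁆∪W-isolated : Isolated (c ∷ C) (⁅ p ⁆ ∪ W)
    ⁅p⁆∪W-isolated {w} w∈⁅p⁆∪W with x∈p∪q⁻ ⁅ p ⁆ W w∈⁅p⁆∪W
    ... | inj₁ w∈⁅p⁆ rewrite x∈⁅y⁆⇒x≡y p w∈⁅p⁆ = c , here refl , (begin
      c ∩ (⁅ p ⁆ ∪ W)           ≡⟨ ∩-distribˡ-∪ c ⁅ p ⁆ W ⟩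
      c ∩ ⁅ p ⁆ ∪ c ∩ W         ≡⟨ cong₂ _∪_ (x∈p⇒p∩⁅x⁆≡⁅x⁆ p∈c) c∩W≡⊥ ⟩
      ⁅ p ⁆ ∪ ⊥                 ≡⟨ ∪-identityʳ ⁅ p ⁆ ⟩
      ⁅ p ⁆                     ∎)
      where open ≡-Reasoning
    ... | inj₂ w∈W =
      let c' , c'∈C , c'∩W≡⁅w⁆ = isolated w∈W
          p∉c' = λ p∈c' → p∉⋃C (LM.lose c'∈C p∈c')
      in c' , there c'∈C , (begin
      c' ∩ (⁅ p ⁆ ∪ W)          ≡⟨ ∩-distribˡ-∪ c' ⁅ p ⁆ W ⟩
      c' ∩ ⁅ p ⁆ ∪ c' ∩ W       ≡⟨ cong₂ _∪_ (x∉p⇒p∩⁅x⁆≡⊥ p∉c') c'∩W≡⁅w⁆ ⟩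
      ⊥ ∪ ⁅ w ⁆                 ≡⟨ ∪-identityˡ ⁅ w ⁆ ⟩
      ⁅ w ⁆                     ∎)
      where open ≡-Reasoning

  largeIsolatedSubset : ∀ (C : List (Subset n)) Z →
    (∀ {c} → c LM.∈ C → ∣ Z ∩ c ∣ ≤ k) → Covers C Z → LargeIsolatedSubset k C Z
  largeIsolatedSubset []      Z _       cover = largeIsolatedSubset-[] cover
  largeIsolatedSubset (c ∷ C) Z bounded cover
    with Fin.any? (λ p → p ∈? Z ×-dec p ∈? c ×-dec ¬? (Any.any? (p ∈?_) C))
  ... | no noPrivate = largeIsolatedSubset-skip
    (largeIsolatedSubset C Z (bounded ∘ there) (covers-redundant cover noPrivate))
  ... | yes (p , p∈Z , p∈c , p∉⋃C) = largeIsolatedSubset-extend p∈Z p∈c p∉⋃C (bounded (here refl))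
    (largeIsolatedSubset C (Z ─ c) bounded─c (covers-∷⁻ cover))
    where
    bounded─c : ∀ {c'} → c' LM.∈ C → ∣ (Z ─ c) ∩ c' ∣ ≤ k
    bounded─c {c'} c'∈C = ≤-trans (p⊆q⇒∣p∣≤∣q∣ Z─c∩c'⊆Z∩c') (bounded (there c'∈C))
      where
      Z─c∩c'⊆Z∩c' : (Z ─ c) ∩ c' ⊆ Z ∩ c'
      Z─c∩c'⊆Z∩c' x∈ = let x∈Z─c , x∈c' = x∈p∩q⁻ (Z ─ c) c' x∈ in x∈p∩q⁺ (p─q⊆p Z c x∈Z─c , x∈c')

indicator-product : ∀ a b →
  not (does ((if a then 1ℚ else 0ℚ) *ℚ (if b then 1ℚ else 0ℚ) ℚ.≟ 0ℚ)) ≡ a ∧ b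
indicator-product true  true  = refl
indicator-product true  false = refl
indicator-product false true  = refl
indicator-product false false = refl

supp-toℚ-∘ᶜ : ∀ (s t : Subset n) → supp (toℚ s ∘ᶜ toℚ t) ≡ s ∩ t
supp-toℚ-∘ᶜ s t = begin
  supp (toℚ s ∘ᶜ toℚ t)                    ≡⟨ tabulate-cong (λ i → indicator-product (lookup s i) (lookup t i)) ⟩
  tabulate (λ i → lookup s i ∧ lookup t i) ≡⟨ tabulate-cong (λ i → lookup-zipWith _∧_ i s t) ⟨
  tabulate (lookup (s ∩ t))                ≡⟨ tabulate∘lookup (s ∩ t) ⟩
  s ∩ t                                    ∎
  where open ≡-Reasoning

isolated⊆H : ∀ {S} {W : Subset n} → Isolated S W → W ⊆ H S (toℚ W)
isolated⊆H {S = S} {W} isolated {w} w∈W =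
  let s , s∈S , s∩W≡⁅w⁆ = isolated w∈W
      singletonSupport = LM.lose s∈S (trans (supp-toℚ-∘ᶜ s W) s∩W≡⁅w⁆)
  in lookup⇒[]= w _ (trans (lookup∘tabulate _ w)
       (dec-true (Any.any? (λ s → ≡-dec _≟ᵇ_ (supp (toℚ s ∘ᶜ toℚ W)) ⁅ w ⁆) S) singletonSupport))

mainTheorem12 : (n : ℕ) (S : List (Subset n)) (Z : Subset n) (k : ℕ) →
    1 ≤ k →
    (∀ i → i ∈ Z → Σ (Subset n) (λ s → (s LM.∈ S) × (i ∈ s) × (∣ Z ∩ s ∣ ≤ k))) →
    (d : ℕ) → IsHHdim S d →
    ∣ Z ∣ ≤ k * d
mainTheorem12 n S Z k _ hyp d hh = begin
  ∣ Z ∣                 ≤⟨ ∣Z∣≤k*∣W∣ ⟩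
  k * ∣ W ∣             ≤⟨ *-monoʳ-≤ k (p⊆q⇒∣p∣≤∣q∣ (isolated⊆H (isolated-⊆ C⊆S isolated))) ⟩
  k * ∣ H S (toℚ W) ∣   ≤⟨ *-monoʳ-≤ k (IsHHdim.upper hh (toℚ W)) ⟩
  k * d                 ∎
  where
  open ≤-Reasoning

  bounded? : ∀ s → Dec (∣ Z ∩ s ∣ ≤ k)
  bounded? s = ∣ Z ∩ s ∣ ≤? k

  C : List (Subset n)
  C = filter bounded? S

  C⊆S : ∀ {c} → c LM.∈ C → c LM.∈ S
  C⊆S = proj₁ ∘ ∈-filter⁻ bounded? {xs = S}

  bounded : ∀ {c} → c LM.∈ C → ∣ Z ∩ c ∣ ≤ k
  bounded = proj₂ ∘ ∈-filter⁻ bounded? {xs = S}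

  cover : Covers C Z
  cover z∈Z = let s , s∈S , z∈s , ∣Z∩s∣≤k = hyp _ z∈Z in LM.lose (∈-filter⁺ bounded? s∈S ∣Z∩s∣≤k) z∈s

  open LargeIsolatedSubset (largeIsolatedSubset C Z bounded cover)
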